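{- Let $N=(P,T,\mathrm{Pre},\mathrm{Post},m_0)$ be a marked Petri net and let $p\in P$ be a redundant place of $N$. Let $N'$ be the net obtained from $N$ by removing place $p$ (i.e. with places $P\setminus\{p\}$, the same transitions, $\mathrm{Pre},\mathrm{Post}$ and $m_0$ restricted to $P\setminus\{p\}$). Then there are an integer constant $k\in\mathbb{N}\setminus\{0\}$ and a linear expression $\rho$ (with integer coefficients and constant term) in the markings of the places of $P\setminus\{p\}$ such that, for every marking $m:P\setminus\{p\}\to\mathbb{N}$, $$m\cup\{(p,(1/k)\cdot\rho(m))\}\in\mathcal{R}(N)\iff m\in\mathcal{R}(N').$$
   Context: A marked Petri net is a tuple $N=(P,T,\mathrm{Pre},\mathrm{Post},m_0)$ with $P,T$ disjoint finite sets, $\mathrm{Pre},\mathrm{Post}:T\to(P\to\mathbb{N})$, and $m_0:P\to\mathbb{N}$. A marking is a map from places to $\mathbb{N}$; a transition $t$ is enabled at $m$ if $m\ge\mathrm{Pre}(t)$ pointwise, and firing it yields $m-\mathrm{Pre}(t)+\mathrm{Post}(t)$. $\mathcal{R}(N)$ is the set of markings reachable from $m_0$ by finitely many firings. A marking over a set of places is written as a set of pairs (place, value), so $m\cup\{(p,x)\}$ extends $m$ by assigning $x$ to $p$. A place $p\in P$ is redundant if there exist a set $I\subseteq P\setminus\{p\}$, a valuation $v:I\cup\{p\}\to\mathbb{N}\setminus\{0\}$ and a constant $b\in\mathbb{N}$ such that: (1) $b=v(p)m_0(p)-\sum_{q\in I}v(q)m_0(q)$; (2) for every $t\in T$, $v(p)\mathrm{Pre}(t)(p)-\sum_{q\in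 I}v(q)\mathrm{Pre}(t)(q)\le b$; (3) for every $t\in T$, $v(p)(\mathrm{Post}(t)(p)-\mathrm{Pre}(t)(p))=\sum_{q\in I}v(q)(\mathrm{Post}(t)(q)-\mathrm{Pre}(t)(q))$. -}

module Defs where

open import Data.Nat using (ℕ; zero; suc; _+_; _∸_; _≤_; NonZero)
open import Data.Integer as ℤ using (ℤ; +_)
open import Data.Fin using (Fin; zero; suc; punchIn)
open import Data.Bool using (Bool; true; false; if_then_else_)
open import Data.Vec.Functional using (Vector; insertAt; removeAt)
open import Data.Product using (Σ; _×_)
open import Relation.Binary.PropositionalEquality using (_≡_; _≢_)

record PetriNet (np nt : ℕ) : Set where
  field
    Pre  : Fin nt → Fin np → ℕ
    Post : Fin nt → Fin np → ℕ
    m0   : Fin np → ℕ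
open PetriNet public

Marking : ℕ → Set
Marking np = Fin np → ℕ

Enabled : ∀ {np nt} → PetriNet np nt → Fin nt → Marking np → Set
Enabled N t m = ∀ q → Pre N t q ≤ m q

-- result of firing t at m (meaningful when t is enabled at m)
fire : ∀ {np nt} → PetriNet np nt → Fin nt → Marking np → Marking np
fire N t m q = (m q ∸ Pre N t q) + Post N t q

data Reach {np nt : ℕ} (N : PetriNet np nt) : Marking np → Set where
  init : ∀ {m} → (∀ q → m q ≡ m0 N q) → Reach N m
  step : ∀ {m m'} (t : Fin nt) → Reach N m → Enabled N t m →
         (∀ q → m' q ≡ fire N t m q) → Reach N m'

sumℤ : ∀ {n} → (Fin n → ℤ) → ℤ
sumℤ {zero}  f = + 0
sumℤ {suc n} f = f zero ℤ.+ sumℤ (λ i → f (suc i))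

Subset : ℕ → Set
Subset n = Fin n → Bool

sumOver : ∀ {n} → Subset n → (Fin n → ℤ) → ℤ
sumOver I f = sumℤ (λ q → if I q then f q else + 0)

-- Redundant place p, following the definition with I ⊆ P∖{p},
-- v : I ∪ {p} → ℕ∖{0} (given as a total function; only values on I ∪ {p}
-- matter) and b ∈ ℕ.
Redundant : ∀ {np nt} → PetriNet np nt → Fin np → Set
Redundant {np} {nt} N p =
  Σ (Subset np) λ I → Σ (Fin np → ℕ) λ v → Σ ℕ λ b →
    (I p ≡ false) ×
    (v p ≢ 0) ×
    (∀ q → I q ≡ true → v q ≢ 0) ×
    (+ b ≡ (+ v p) ℤ.* (+ m0 N p) ℤ.- sumOver I (λ q → (+ v q) ℤ.* (+ m0 N q))) ×
    (∀ t → ((+ v p) ℤ.* (+ Pre N t p) ℤ.- sumOver I (λ q → (+ v q) ℤ.* (+ Pre N t q))) ℤ.≤ + b) ×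
    (∀ t → (+ v p) ℤ.* ((+ Post N t p) ℤ.- (+ Pre N t p))
           ≡ sumOver I (λ q → (+ v q) ℤ.* ((+ Post N t q) ℤ.- (+ Pre N t q))))

-- The net N' obtained by removing place p (places Fin np, embedded into
-- Fin (suc np) via punchIn p).
removePlace : ∀ {np nt} → PetriNet (suc np) nt → Fin (suc np) → PetriNet np nt
removePlace N p = record
  { Pre  = λ t → removeAt (Pre N t) p
  ; Post = λ t → removeAt (Post N t) p
  ; m0   = removeAt (m0 N) p }

record LinExpr (n : ℕ) : Set where
  field
    coeff : Fin n → ℤ
    const : ℤ
open LinExpr public

evalLin : ∀ {n} → LinExpr n → Marking n → ℤ
evalLin ρ m = const ρ ℤ.+ sumℤ (λ q → coeff ρ q ℤ.* (+ m q))

module Submission where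

-- The redundancy conditions make v(p)·M(p) = b + Σ_{q∈I} v(q)·M(q) an invariant of N:
-- it holds at m₀ by (1) and every firing preserves it by (3).  So on reachable markings
-- the tokens in p are determined by the other places, with k = v(p) and
-- ρ(m) = b + Σ_{q∈I} v(q)·m(q).  Conversely, along a firing sequence of N' the
-- invariant and (2) show that whenever t is enabled on the places other than p it
-- also has enough tokens in p, so every firing sequence of N' lifts to N.

open import Defs
open import Data.Nat using (ℕ; suc; NonZero)
open import Data.Integer using (+_; _*_)
open import Data.Fin using (Fin)
open import Data.Product using (Σ; _×_)
open import Data.Vec.Functional using (insertAt)
open import Function.Bundles using (_⇔_)
open import Relation.Binary.PropositionalEquality using (_≡_)

import Data.Nat as ℕ
import Data.Nat.Properties as ℕ
open import Data.Integer using (ℤ; _+_; _-_; _⊖_; _≤_; +≤+)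
import Data.Integer.Properties as ℤ
open import Data.Integer.Tactic.RingSolver using (solve-∀)
open import Data.Fin using (zero; suc; punchIn; punchOut; _≟_)
open import Data.Fin.Properties using (punchIn-punchOut)
open import Data.Vec.Functional using (removeAt)
open import Data.Vec.Functional.Properties
  using (insertAt-lookup; insertAt-punchIn; removeAt-insertAt)
open import Data.Bool using (true; false; if_then_else_)
open import Data.Product using (_,_)
open import Function.Bundles using (mk⇔)
open import Relation.Nullary using (yes; no)
open import Relation.Binary.PropositionalEquality
  using (refl; sym; trans; cong; cong₂; subst; subst₂; _≢_; _≗_; module ≡-Reasoning)

i-j+j≡i : ∀ i j → (i - j) + j ≡ i
i-j+j≡i = solve-∀

sumℤ-cong : ∀ {n} {f g : Fin n → ℤ} → f ≗ g → sumℤ f ≡ sumℤ g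
sumℤ-cong {ℕ.zero} f≗g = refl
sumℤ-cong {suc n}  f≗g = cong₂ _+_ (f≗g zero) (sumℤ-cong (λ q → f≗g (suc q)))

sumℤ-distrib-+ : ∀ {n} (f g : Fin n → ℤ) →
  sumℤ (λ q → f q + g q) ≡ sumℤ f + sumℤ g
sumℤ-distrib-+ {ℕ.zero} f g = refl
sumℤ-distrib-+ {suc n}  f g = begin
  (f zero + g zero) + sumℤ (λ q → f (suc q) + g (suc q))
    ≡⟨ cong (λ s → (f zero + g zero) + s) (sumℤ-distrib-+ (λ q → f (suc q)) (λ q → g (suc q))) ⟩
  (f zero + g zero) + (sumℤ (λ q → f (suc q)) + sumℤ (λ q → g (suc q)))
    ≡⟨ interchange (f zero) (g zero) _ _ ⟩
  (f zero + sumℤ (λ q → f (suc q))) + (g zero + sumℤ (λ q → g (suc q)))  ∎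
  where
  open ≡-Reasoning
  interchange : ∀ a b c d → (a + b) + (c + d) ≡ (a + c) + (b + d)
  interchange = solve-∀

sumℤ-mono-≤ : ∀ {n} {f g : Fin n → ℤ} → (∀ q → f q ≤ g q) → sumℤ f ≤ sumℤ g
sumℤ-mono-≤ {ℕ.zero} f≤g = ℤ.≤-refl
sumℤ-mono-≤ {suc n}  f≤g = ℤ.+-mono-≤ (f≤g zero) (sumℤ-mono-≤ (λ q → f≤g (suc q)))

sumℤ-punchIn : ∀ {n} (p : Fin (suc n)) (f : Fin (suc n) → ℤ) →
  sumℤ f ≡ f p + sumℤ (λ q → f (punchIn p q))
sumℤ-punchIn zero          f = refl
sumℤ-punchIn {suc n} (suc p) f =
  trans (cong (λ s → f zero + s) (sumℤ-punchIn p (λ q → f (suc q))))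
        (left-comm (f zero) (f (suc p)) _)
  where
  left-comm : ∀ a b c → a + (b + c) ≡ b + (a + c)
  left-comm = solve-∀

infix 7 _·_

_·_ : ∀ {n} → (Fin n → ℕ) → (Fin n → ℤ) → ℤ
w · f = sumℤ (λ q → + w q * f q)

·-congˡ : ∀ {n} (w : Fin n → ℕ) {f g : Fin n → ℤ} → f ≗ g → w · f ≡ w · g
·-congˡ w f≗g = sumℤ-cong (λ q → cong (λ s → + w q * s) (f≗g q))

·-distribˡ-+ : ∀ {n} (w : Fin n → ℕ) (f g : Fin n → ℤ) →
  w · (λ q → f q + g q) ≡ w · f + w · g
·-distribˡ-+ w f g =
  trans (sumℤ-cong (λ q → ℤ.*-distribˡ-+ (+ w q) (f q) (g q)))
        (sumℤ-distrib-+ (λ q → + w q * f q) (λ q → + w q * g q))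

·-monoˡ-≤ : ∀ {n} (w : Fin n → ℕ) {f g : Fin n → ℤ} → (∀ q → f q ≤ g q) → w · f ≤ w · g
·-monoˡ-≤ w f≤g = sumℤ-mono-≤ (λ q → ℤ.*-monoˡ-≤-nonNeg (+ w q) (f≤g q))

·-punchIn : ∀ {n} (p : Fin (suc n)) (w : Fin (suc n) → ℕ) (f : Fin (suc n) → ℤ) →
  w p ≡ 0 → w · f ≡ removeAt w p · removeAt f p
·-punchIn p w f wp≡0 = begin
  w · f                                              ≡⟨ sumℤ-punchIn p (λ q → + w q * f q) ⟩
  + w p * f p + removeAt w p · removeAt f p          ≡⟨ cong (λ c → + c * f p + removeAt w p · removeAt f p) wp≡0 ⟩
  + 0 * f p + removeAt w p · removeAt f p            ≡⟨ ℤ.+-identityˡ (removeAt w p · removeAt f p) ⟩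
  removeAt w p · removeAt f p                        ∎
  where open ≡-Reasoning

restrict : ∀ {n} → Subset n → (Fin n → ℕ) → Fin n → ℕ
restrict I v q = if I q then v q else 0

sumOver-· : ∀ {n} (I : Subset n) (v : Fin n → ℕ) (f : Fin n → ℤ) →
  sumOver I (λ q → + v q * f q) ≡ restrict I v · f
sumOver-· I v f = sumℤ-cong pointwise
  where
  pointwise : ∀ q → (if I q then + v q * f q else + 0) ≡ + restrict I v q * f q
  pointwise q with I q
  ... | true  = refl
  ... | false = refl

∀-punchIn : ∀ {n} {P : Fin (suc n) → Set} (p : Fin (suc n)) →
  P p → (∀ q → P (punchIn p q)) → ∀ q → P q
∀-punchIn {P = P} p Pp Ppunch q with p ≟ q
... | yes refl = Pp
... | no  p≢q  = subst P (punchIn-punchOut p≢q) (Ppunch (punchOut p≢q))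

insertAt-removeAt-≗ : ∀ {n} {m : Fin n → ℕ} (M : Fin (suc n) → ℕ) (p : Fin (suc n)) →
  m ≗ removeAt M p → insertAt m p (M p) ≗ M
insertAt-removeAt-≗ {m = m} M p m≗M =
  ∀-punchIn p (insertAt-lookup m p (M p))
    (λ q → trans (insertAt-punchIn m p (M p) q) (m≗M q))

module _ {np nt : ℕ} where

  Reach-resp : {N : PetriNet np nt} {m m' : Marking np} → m ≗ m' → Reach N m → Reach N m'
  Reach-resp m≗m' (init m≗m0)        = init (λ q → trans (sym (m≗m' q)) (m≗m0 q))
  Reach-resp m≗m' (step t r en m≗fm) = step t r en (λ q → trans (sym (m≗m' q)) (m≗fm q))

  fire-ℤ : (N : PetriNet np nt) (t : Fin nt) {M : Marking np} → Enabled N t M →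
    ∀ q → + fire N t M q ≡ + M q + (+ Post N t q - + Pre N t q)
  fire-ℤ N t {M} en q = begin
    + ((M q ℕ.∸ Pre N t q) ℕ.+ Post N t q)      ≡⟨ ℤ.pos-+ (M q ℕ.∸ Pre N t q) (Post N t q) ⟩
    + (M q ℕ.∸ Pre N t q) + + Post N t q        ≡⟨ cong (_+ + Post N t q) (sym (ℤ.≤-⊖ (en q))) ⟩
    (M q ⊖ Pre N t q) + + Post N t q            ≡⟨ cong (_+ + Post N t q) (sym (ℤ.m-n≡m⊖n (M q) (Pre N t q))) ⟩
    (+ M q - + Pre N t q) + + Post N t q        ≡⟨ rearrange (+ M q) (+ Pre N t q) (+ Post N t q) ⟩
    + M q + (+ Post N t q - + Pre N t q)        ∎
    where
    open ≡-Reasoning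
    rearrange : ∀ x y z → (x - y) + z ≡ x + (z - y)
    rearrange = solve-∀

module _ {np nt : ℕ} (N : PetriNet (suc np) nt) (p : Fin (suc np)) where

  Reach-removePlace : ∀ {M} → Reach N M → Reach (removePlace N p) (removeAt M p)
  Reach-removePlace (init M≗m0)        = init (λ q → M≗m0 (punchIn p q))
  Reach-removePlace (step t r en M≗fM) =
    step t (Reach-removePlace r) (λ q → en (punchIn p q)) (λ q → M≗fM (punchIn p q))

  module Lift (Inv : Marking (suc np) → Set)
    (Inv-m0   : Inv (m0 N))
    (Inv-fire : ∀ {t} M → Inv M → Enabled N t M → Inv (fire N t M))
    (Inv-Pre  : ∀ {t} M → Inv M → Enabled (removePlace N p) t (removeAt M p) → Pre N t p ℕ.≤ M p)
    where

    Reach-lift : ∀ {m} → Reach (removePlace N p) m →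
      Σ (Marking (suc np)) λ M → Reach N M × Inv M × m ≗ removeAt M p
    Reach-lift (init m≗m0) = m0 N , init (λ _ → refl) , Inv-m0 , m≗m0
    Reach-lift {m} (step t r en' m≗fm) with Reach-lift r
    ... | M , R , inv , m'≗M = fire N t M , step t R en (λ _ → refl) , Inv-fire M inv en , m≗fM
      where
      enN' : Enabled (removePlace N p) t (removeAt M p)
      enN' q = subst (Pre N t (punchIn p q) ℕ.≤_) (m'≗M q) (en' q)
      en : Enabled N t M
      en = ∀-punchIn p (Inv-Pre M inv enN') enN'
      m≗fM : m ≗ removeAt (fire N t M) p
      m≗fM q = trans (m≗fm q)
        (cong (λ x → (x ℕ.∸ Pre N t (punchIn p q)) ℕ.+ Post N t (punchIn p q)) (m'≗M q))

module RedundantPlace {np nt : ℕ} (N : PetriNet (suc np) nt) (p : Fin (suc np))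
  (I : Subset (suc np)) (v : Fin (suc np) → ℕ) (b : ℕ)
  (p∉I : I p ≡ false) (vp≢0 : v p ≢ 0)
  (initial : + b ≡ + v p * + m0 N p - sumOver I (λ q → + v q * + m0 N q))
  (bounded : ∀ t → + v p * + Pre N t p - sumOver I (λ q → + v q * + Pre N t q) ≤ + b)
  (balanced : ∀ t → + v p * (+ Post N t p - + Pre N t p)
                  ≡ sumOver I (λ q → + v q * (+ Post N t q - + Pre N t q)))
  where

  w : Fin (suc np) → ℕ
  w = restrict I v

  wp≡0 : w p ≡ 0
  wp≡0 = cong (λ β → if β then v p else 0) p∉I

  Δ : Fin nt → Fin (suc np) → ℤ
  Δ t q = + Post N t q - + Pre N t q

  ⌜_⌝ : Marking (suc np) → Fin (suc np) → ℤ
  ⌜ M ⌝ q = + M q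

  Inv : Marking (suc np) → Set
  Inv M = + v p * + M p ≡ + b + w · ⌜ M ⌝

  Inv-m0 : Inv (m0 N)
  Inv-m0 = begin
    + v p * + m0 N p                                ≡⟨ i-j+j≡i (+ v p * + m0 N p) (w · ⌜ m0 N ⌝) ⟨
    (+ v p * + m0 N p - w · ⌜ m0 N ⌝) + w · ⌜ m0 N ⌝  ≡⟨ cong (_+ w · ⌜ m0 N ⌝) initial′ ⟨
    + b + w · ⌜ m0 N ⌝                              ∎
    where
    open ≡-Reasoning
    initial′ : + b ≡ + v p * + m0 N p - w · ⌜ m0 N ⌝
    initial′ = trans initial (cong (λ s → + v p * + m0 N p - s) (sumOver-· I v ⌜ m0 N ⌝))

  Inv-fire : ∀ {t} M → Inv M → Enabled N t M → Inv (fire N t M)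
  Inv-fire {t} M inv en = begin
    + v p * + fire N t M p               ≡⟨ cong (λ s → + v p * s) (fire-ℤ N t en p) ⟩
    + v p * (+ M p + Δ t p)              ≡⟨ ℤ.*-distribˡ-+ (+ v p) (+ M p) (Δ t p) ⟩
    + v p * + M p + + v p * Δ t p        ≡⟨ cong₂ _+_ inv (trans (balanced t) (sumOver-· I v (Δ t))) ⟩
    (+ b + w · ⌜ M ⌝) + w · Δ t          ≡⟨ ℤ.+-assoc (+ b) (w · ⌜ M ⌝) (w · Δ t) ⟩
    + b + (w · ⌜ M ⌝ + w · Δ t)          ≡⟨ cong (_+_ (+ b)) (·-distribˡ-+ w ⌜ M ⌝ (Δ t)) ⟨
    + b + w · (λ q → + M q + Δ t q)      ≡⟨ cong (_+_ (+ b)) (·-congˡ w (λ q → sym (fire-ℤ N t en q))) ⟩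
    + b + w · ⌜ fire N t M ⌝             ∎
    where open ≡-Reasoning

  Inv-Pre : ∀ {t} M → Inv M → Enabled (removePlace N p) t (removeAt M p) → Pre N t p ℕ.≤ M p
  Inv-Pre {t} M inv en' = ℕ.*-cancelˡ-≤ (v p) {{ℕ.≢-nonZero vp≢0}} (ℤ.drop‿+≤+ (begin
    + (v p ℕ.* Pre N t p)                      ≡⟨ ℤ.pos-* (v p) (Pre N t p) ⟩
    + v p * + Pre N t p                        ≡⟨ i-j+j≡i (+ v p * + Pre N t p) (w · pre) ⟨
    (+ v p * + Pre N t p - w · pre) + w · pre  ≤⟨ ℤ.+-mono-≤ bounded′ pre≤M ⟩
    + b + w · ⌜ M ⌝                            ≡⟨ inv ⟨
    + v p * + M p                              ≡⟨ ℤ.pos-* (v p) (M p) ⟨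
    + (v p ℕ.* M p)                            ∎))
    where
    open ℤ.≤-Reasoning
    pre : Fin (suc np) → ℤ
    pre q = + Pre N t q
    bounded′ : + v p * + Pre N t p - w · pre ≤ + b
    bounded′ = subst (λ s → + v p * + Pre N t p - s ≤ + b) (sumOver-· I v pre) (bounded t)
    -- w vanishes at p, so only the places of N', where t is enabled, contribute.
    pre≤M : w · pre ≤ w · ⌜ M ⌝
    pre≤M = subst₂ _≤_ (sym (·-punchIn p w pre wp≡0)) (sym (·-punchIn p w ⌜ M ⌝ wp≡0))
      (·-monoˡ-≤ (removeAt w p) (λ q → +≤+ (en' q)))

  open Lift N p Inv Inv-m0 Inv-fire Inv-Pre

  ρ : LinExpr np
  ρ = record { coeff = λ q → + removeAt w p q ; const = + b }

  Inv⇒evalLin : ∀ {m} M → Inv M → m ≗ removeAt M p → + v p * + M p ≡ evalLin ρ m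
  Inv⇒evalLin {m} M inv m≗M = begin
    + v p * + M p                          ≡⟨ inv ⟩
    + b + w · ⌜ M ⌝                        ≡⟨ cong (_+_ (+ b)) (·-punchIn p w ⌜ M ⌝ wp≡0) ⟩
    + b + removeAt w p · removeAt ⌜ M ⌝ p  ≡⟨ cong (_+_ (+ b)) (·-congˡ (removeAt w p) m≗M′) ⟨
    evalLin ρ m                            ∎
    where
    open ≡-Reasoning
    m≗M′ : (λ q → + m q) ≗ removeAt ⌜ M ⌝ p
    m≗M′ q = cong +_ (m≗M q)

  Reach-insertAt⇔Reach-removePlace : ∀ m →
    (Σ ℕ λ x → (+ v p * + x ≡ evalLin ρ m) × Reach N (insertAt m p x)) ⇔ Reach (removePlace N p) m
  Reach-insertAt⇔Reach-removePlace m = mk⇔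
    (λ { (x , _ , r) → Reach-resp (removeAt-insertAt m p x) (Reach-removePlace N p r) })
    lift
    where
    lift : Reach (removePlace N p) m →
      Σ ℕ λ x → (+ v p * + x ≡ evalLin ρ m) × Reach N (insertAt m p x)
    lift r with Reach-lift r
    ... | M , R , inv , m≗M =
      M p , Inv⇒evalLin M inv m≗M , Reach-resp (λ q → sym (insertAt-removeAt-≗ M p m≗M q)) R

theorem2 : ∀ {np nt} (N : PetriNet (suc np) nt) (p : Fin (suc np)) →
    Redundant N p →
    Σ ℕ λ k → NonZero k × Σ (LinExpr np) λ ρ →
      ∀ (m : Marking np) →
        (Σ ℕ λ x → ((+ k) * (+ x) ≡ evalLin ρ m) × Reach N (insertAt m p x))
          ⇔ Reach (removePlace N p) m
theorem2 N p (I , v , b , p∉I , vp≢0 , _ , initial , bounded , balanced) =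
  v p , ℕ.≢-nonZero vp≢0 , ρ , Reach-insertAt⇔Reach-removePlace
  where open RedundantPlace N p I v b p∉I vp≢0 initial bounded balanced
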